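{- Let $A$ be a linear transition system and let $\mathcal{R}$ be a set of regions of $A$ that is a witness for the ESSP of $A$. Then $\mathcal{R}$ is a witness for the SSP of $A$.
   Context: A linear transition system is $A = s_0\xrightarrow{e_1}s_1\xrightarrow{e_2}\cdots\xrightarrow{e_t}s_t$ with pairwise distinct states $s_0,\dots,s_t$, edges exactly $s_{i-1}\xrightarrow{e_i}s_i$, event set $E=\{e_1,\dots,e_t\}$ (events may repeat along the path) and initial state $s_0$. A region is a set $R$ of states with a signature $sig_R:E\to\{ -1,0,1\}$ satisfying $R(s_i)=R(s_{i-1})+sig_R(e_i)$ for all $i$, where $R(s)=1$ if $s\in R$ and $0$ otherwise. A region $R$ separates $s,s'$ if $R(s)\neq R(s')$; $R$ inhibits event $e$ at state $s$ if ($R(s)=0$ and $sig_R(e)=-1$) or ($R(s)=1$ and $sig_R(e)=1$). A set $\mathcal{R}$ of regions is a witness for the ESSP of $A$ if for every state $s$ and event $e$ such that there is no edge $s\xrightarrow{e}$ leaving $s$, some region in $\mathcal{R}$ inhibits $e$ at $s$; it is a witness for the SSP of $A$ if every two distinct states are separated by some region in $\mathcal{R}$. -}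

module Defs where

open import Data.Nat using (ℕ; suc)
open import Data.Fin using (Fin; toℕ; inject₁) renaming (suc to fsuc)
open import Data.Integer using (ℤ; _+_; +_; -[1+_])
open import Data.Product using (Σ; _×_; ∃)
open import Relation.Binary.PropositionalEquality using (_≡_; _≢_)
open import Relation.Nullary using (¬_)
open import Data.Sum using (_⊎_)

-- A linear transition system s₀ -e₁-> s₁ -> ... -eₜ-> sₜ.
-- States: Fin (suc t) (state k is s_k; pairwise distinct by construction).
-- Edges: for j : Fin t, edge from s_j (inject₁ j) to s_{j+1} (fsuc j) labelled (label j).
-- Event set E: the type Ev together with surjectivity of label (E = {e₁,…,eₜ}).
record LTS : Set₁ where
  field
    t      : ℕ
    Ev     : Set
    label  : Fin t → Ev
    label-surj : (e : Ev) → ∃ λ j → label j ≡ e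

State : LTS → Set
State A = Fin (suc (LTS.t A))

HasEdge : (A : LTS) → State A → LTS.Ev A → Set
HasEdge A s e = ∃ λ (j : Fin (LTS.t A)) → (inject₁ j ≡ s) × (LTS.label A j ≡ e)

data Sig : Set where
  minus nil plus : Sig

sigℤ : Sig → ℤ
sigℤ minus = -[1+ 0 ]
sigℤ nil   = + 0
sigℤ plus  = + 1

data Bit : Set where
  b0 b1 : Bit

bitℤ : Bit → ℤ
bitℤ b0 = + 0
bitℤ b1 = + 1

record Region (A : LTS) : Set where
  field
    mem : State A → Bit
    sig : LTS.Ev A → Sig
    consistent : (j : Fin (LTS.t A)) →
      bitℤ (mem (fsuc j)) ≡ bitℤ (mem (inject₁ j)) + sigℤ (sig (LTS.label A j))

Separates : {A : LTS} → Region A → State A → State A → Set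
Separates R s s' = Region.mem R s ≢ Region.mem R s'

Inhibits : {A : LTS} → Region A → LTS.Ev A → State A → Set
Inhibits R e s =
  (Region.mem R s ≡ b0 × Region.sig R e ≡ minus) ⊎
  (Region.mem R s ≡ b1 × Region.sig R e ≡ plus)

-- a set of regions, given as an indexed family ℛ : I → Region A
ESSPWitness : (A : LTS) {I : Set} → (I → Region A) → Set
ESSPWitness A {I} ℛ = (s : State A) (e : LTS.Ev A) → ¬ HasEdge A s e →
  ∃ λ (i : I) → Inhibits (ℛ i) e s

SSPWitness : (A : LTS) {I : Set} → (I → Region A) → Set
SSPWitness A {I} ℛ = (s s' : State A) → s ≢ s' →
  ∃ λ (i : I) → Separates (ℛ i) s s'

module Submission where

-- First, a region never inhibits an event at
-- a state where that event occurs (the step would leave {0,1}); hence a region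
-- inhibiting eᵢ₊₁ at a state s separates sᵢ from s.  Second, in a linear system
-- the only event leaving sⱼ is eⱼ₊₁, and the last state sₜ has no event at all.
--
-- We separate sᵢ from sⱼ for i < j by downward induction on j
-- (Data.Fin.Induction.>-weakInduction).  For j = t, eᵢ₊₁ is disabled at sₜ, so
-- the inhibiting region separates.  For j < t, some region R separates sᵢ₊₁
-- from sⱼ₊₁.  Either R already separates sᵢ from sⱼ, or R(sᵢ) = R(sⱼ); then the
-- signatures of eᵢ₊₁ and eⱼ₊₁ differ, so eᵢ₊₁ ≠ eⱼ₊₁ is disabled at sⱼ and the
-- region inhibiting it there separates.  The theorem follows by trichotomy.

open import Defs
open import Data.Nat as ℕ using (suc)
open import Data.Nat.Properties as ℕₚ using (<-≤-trans)
open import Data.Fin using (Fin; toℕ; inject₁; fromℕ; lower₁; _<_)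
  renaming (suc to fsuc)
open import Data.Fin.Properties
  using (toℕ<n; toℕ-inject₁; inject₁-injective; inject₁-lower₁; fromℕ≢inject₁; <-cmp)
open import Data.Fin.Induction using (>-weakInduction)
open import Data.Integer using (_+_)
open import Data.Product using (_×_; ∃; _,_)
open import Data.Sum using (_⊎_; inj₁; inj₂)
open import Data.Empty using (⊥-elim)
open import Relation.Nullary using (¬_; yes; no; Dec)
open import Relation.Binary using (tri<; tri≈; tri>)
open import Relation.Binary.PropositionalEquality
  using (_≡_; _≢_; refl; sym; trans; cong₂; subst₂; ≢-sym; module ≡-Reasoning)

_≟-bit_ : (x y : Bit) → Dec (x ≡ y)
b0 ≟-bit b0 = yes refl
b0 ≟-bit b1 = no λ ()
b1 ≟-bit b0 = no λ ()
b1 ≟-bit b1 = yes refl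

bitℤ-injective : ∀ {x y} → bitℤ x ≡ bitℤ y → x ≡ y
bitℤ-injective {b0} {b0} _ = refl
bitℤ-injective {b1} {b1} _ = refl
bitℤ-injective {b0} {b1} ()
bitℤ-injective {b1} {b0} ()

step-not-inhibited : ∀ {b b' σ} →
  (b ≡ b0 × σ ≡ minus) ⊎ (b ≡ b1 × σ ≡ plus) → ¬ (bitℤ b' ≡ bitℤ b + sigℤ σ)
step-not-inhibited {b' = b0} (inj₁ (refl , refl)) ()
step-not-inhibited {b' = b1} (inj₁ (refl , refl)) ()
step-not-inhibited {b' = b0} (inj₂ (refl , refl)) ()
step-not-inhibited {b' = b1} (inj₂ (refl , refl)) ()

-- Every state strictly below another is not the last one, so it is inject₁ of
-- a source state of some edge.
below-is-source : ∀ {n} {i j : Fin (suc n)} → i < j → ∃ λ i' → inject₁ i' ≡ i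
below-is-source {n} {i} {j} i<j = lower₁ i n≢i , inject₁-lower₁ i n≢i
  where
  n≢i : n ≢ toℕ i
  n≢i = ≢-sym (ℕₚ.<⇒≢ (<-≤-trans i<j (ℕ.s≤s⁻¹ (toℕ<n j))))

module _ {A : LTS} where
  open LTS A

  enabled-not-inhibited : (R : Region A) (j : Fin t) →
    ¬ Inhibits R (label j) (inject₁ j)
  enabled-not-inhibited R j inh = step-not-inhibited inh (Region.consistent R j)

  inhibition-separates : (R : Region A) (j : Fin t) (s : State A) →
    Inhibits R (label j) s → Separates R (inject₁ j) s
  inhibition-separates R j s (inj₁ (m , σ)) same =
    enabled-not-inhibited R j (inj₁ (trans same m , σ))
  inhibition-separates R j s (inj₂ (m , σ)) same =
    enabled-not-inhibited R j (inj₂ (trans same m , σ))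

  same-event-same-step : (R : Region A) (i j : Fin t) →
    Region.mem R (inject₁ i) ≡ Region.mem R (inject₁ j) →
    label i ≡ label j → Region.mem R (fsuc i) ≡ Region.mem R (fsuc j)
  same-event-same-step R i j same-mem same-label = bitℤ-injective (begin
    bitℤ (Region.mem R (fsuc i))
      ≡⟨ Region.consistent R i ⟩
    bitℤ (Region.mem R (inject₁ i)) + sigℤ (Region.sig R (label i))
      ≡⟨ cong₂ (λ b e → bitℤ b + sigℤ (Region.sig R e)) same-mem same-label ⟩
    bitℤ (Region.mem R (inject₁ j)) + sigℤ (Region.sig R (label j))
      ≡⟨ sym (Region.consistent R j) ⟩
    bitℤ (Region.mem R (fsuc j)) ∎)
    where open ≡-Reasoning

  only-edge : (j : Fin t) (e : Ev) → HasEdge A (inject₁ j) e → label j ≡ e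
  only-edge j e (j' , j'≡j , label≡e) with inject₁-injective j'≡j
  ... | refl = label≡e

  last-state-dead : (e : Ev) → ¬ HasEdge A (fromℕ t) e
  last-state-dead e (j , j≡last , _) = fromℕ≢inject₁ (sym j≡last)

  module _ {I : Set} (ℛ : I → Region A) (essp : ESSPWitness A ℛ) where

    Separated : State A → State A → Set
    Separated s s' = ∃ λ k → Separates (ℛ k) s s'

    separate-by-disabled : (i : Fin t) (s : State A) →
      ¬ HasEdge A s (label i) → Separated (inject₁ i) s
    separate-by-disabled i s disabled with essp s (label i) disabled
    ... | k , inh = k , inhibition-separates (ℛ k) i s inh

    separate-predecessors : (i j : Fin t) →
      Separated (fsuc i) (fsuc j) → Separated (inject₁ i) (inject₁ j)
    separate-predecessors i j (k , sep)
      with Region.mem (ℛ k) (inject₁ i) ≟-bit Region.mem (ℛ k) (inject₁ j)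
    ... | no differ = k , differ
    ... | yes same = separate-by-disabled i (inject₁ j) λ edge →
      sep (same-event-same-step (ℛ k) i j same (sym (only-edge j (label i) edge)))

    separate-from-earlier : (j i : State A) → i < j → Separated i j
    separate-from-earlier = >-weakInduction (λ j → ∀ i → i < j → Separated i j)
      from-last from-successor
      where
      from-last : ∀ i → i < fromℕ t → Separated i (fromℕ t)
      from-last i i<last with below-is-source i<last
      ... | i' , refl = separate-by-disabled i' (fromℕ t) (last-state-dead (label i'))

      from-successor : ∀ j → (∀ i → i < fsuc j → Separated i (fsuc j)) →
        ∀ i → i < inject₁ j → Separated i (inject₁ j)
      from-successor j ih i i<j with below-is-source i<j
      ... | i' , refl = separate-predecessors i' j (ih (fsuc i') (ℕ.s<s
        (subst₂ ℕ._<_ (toℕ-inject₁ i') (toℕ-inject₁ j) i<j)))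

lemma6 : (A : LTS) {I : Set} (ℛ : I → Region A) →
    ESSPWitness A ℛ → SSPWitness A ℛ
lemma6 A ℛ essp s s' s≢s' with <-cmp s s'
... | tri< s<s' _ _ = separate-from-earlier ℛ essp s' s s<s'
... | tri≈ _ s≡s' _ = ⊥-elim (s≢s' s≡s')
... | tri> _ _ s'<s with separate-from-earlier ℛ essp s s' s'<s
...   | k , sep = k , λ same → sep (sym same)
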